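{- Expand the language of Nelson's logic $\mathcal S$ by the defined connectives $1:=\neg0$ and $\varphi*\psi:=\neg(\varphi\Rightarrow\neg\psi)$, and in $\mathcal S'$ read $\neg\varphi$ as $\varphi\Rightarrow 0$. Then the calculi $\mathcal S$ and $\mathcal S'$ define the same consequence relation.
   Context: Nelson's logic $\mathcal S$ is the sentential logic in the language $\langle\land,\lor,\Rightarrow,\neg,0\rangle$ (types $2,2,2,1,0$) given by the following Hilbert-style calculus. Abbreviations: $\phi\Leftrightarrow\psi:=(\phi\Rightarrow\psi)\land(\psi\Rightarrow\phi)$, $1:=\neg 0$, $\phi\Rightarrow^2\psi:=\phi\Rightarrow(\phi\Rightarrow\psi)$; for a finite (possibly empty) list $\Gamma=(\phi_1,\dots,\phi_n)$ of formulas, $\Gamma\Rightarrow\phi:=\phi_1\Rightarrow(\phi_2\Rightarrow(\cdots(\phi_n\Rightarrow\phi)\cdots))$ and $\Gamma\Rightarrow^2\phi:=\phi_1\Rightarrow^2(\phi_2\Rightarrow^2(\cdots(\phi_n\Rightarrow^2\phi)\cdots))$, both being $\phi$ if $\Gamma$ is empty. Axiom schemata: (A1) $\phi\Rightarrow\phi$; (A2) $0\Rightarrow\psi$; (A3) $\neg\phi\Rightarrow(\phi\Rightarrow0)$; (A4) $1$; (A5) $(\phi\Rightarrow\psi)\Leftrightarrow(\neg\psi\Rightarrow\neg\phi)$. Rule schemata (for all formulas and every finite list $\Gamma$), written "premisses / conclusion": (P) $\Gamma\Rightarrow(\phi\Rightarrow(\psi\Rightarrow\gamma))$ / $\Gamma\Rightarrow(\psi\Rightarrow(\phi\Rightarrow\gamma))$;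 (C) $\phi\Rightarrow(\phi\Rightarrow(\phi\Rightarrow\gamma))$ / $\phi\Rightarrow(\phi\Rightarrow\gamma)$; (E) $\Gamma\Rightarrow\phi$, $\phi\Rightarrow\gamma$ / $\Gamma\Rightarrow\gamma$; ($\Rightarrow$l) $\Gamma\Rightarrow\phi$, $\psi\Rightarrow\gamma$ / $\Gamma\Rightarrow((\phi\Rightarrow\psi)\Rightarrow\gamma)$; ($\Rightarrow$r) $\gamma$ / $\phi\Rightarrow\gamma$; ($\land$l1) $\phi\Rightarrow\gamma$ / $(\phi\land\psi)\Rightarrow\gamma$; ($\land$l2) $\psi\Rightarrow\gamma$ / $(\phi\land\psi)\Rightarrow\gamma$; ($\land$r) $\Gamma\Rightarrow\phi$, $\Gamma\Rightarrow\psi$ / $\Gamma\Rightarrow(\phi\land\psi)$; ($\lor$l1) $\phi\Rightarrow\gamma$, $\psi\Rightarrow\gamma$ / $(\phi\lor\psi)\Rightarrow\gamma$; ($\lor$l2) $\phi\Rightarrow^2\gamma$, $\psi\Rightarrow^2\gamma$ / $(\phi\lor\psi)\Rightarrow^2\gamma$; ($\lor$r1) $\Gamma\Rightarrow\phi$ / $\Gamma\Rightarrow(\phi\lor\psi)$; ($\lor$r2) $\Gamma\Rightarrow\psi$ / $\Gamma\Rightarrow(\phi\lor\psi)$; ($\neg\Rightarrow$l) $(\phi\land\neg\psi)\Rightarrow\gamma$ / $\neg(\phi\Rightarrow\psi)\Rightarrow\gamma$; ($\neg\Rightarrow$r) $\Gamma\Rightarrow^2(\phi\land\neg\psi)$ /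 $\Gamma\Rightarrow^2\neg(\phi\Rightarrow\psi)$; ($\neg\land$l) $(\neg\phi\lor\neg\psi)\Rightarrow\gamma$ / $\neg(\phi\land\psi)\Rightarrow\gamma$; ($\neg\land$r) $\Gamma\Rightarrow(\neg\phi\lor\neg\psi)$ / $\Gamma\Rightarrow\neg(\phi\land\psi)$; ($\neg\lor$l) $(\neg\phi\land\neg\psi)\Rightarrow\gamma$ / $\neg(\phi\lor\psi)\Rightarrow\gamma$; ($\neg\lor$r) $\Gamma\Rightarrow(\neg\phi\land\neg\psi)$ / $\Gamma\Rightarrow\neg(\phi\lor\psi)$; ($\neg\neg$l) $\phi\Rightarrow\gamma$ / $\neg\neg\phi\Rightarrow\gamma$; ($\neg\neg$r) $\Gamma\Rightarrow\phi$ / $\Gamma\Rightarrow\neg\neg\phi$. The consequence relation $\vdash_{\mathcal S}$ is derivability by finite derivations in this calculus. $\mathcal S'$ is the sentential logic in the language $\langle\land,\lor,*,\Rightarrow,0,1\rangle$ defined by the Hilbert-style calculus whose only rule is modus ponens and whose axiom schemata are: (S1) $(\varphi\Rightarrow\psi)\Rightarrow((\psi\Rightarrow\gamma)\Rightarrow(\varphi\Rightarrow\gamma))$; (S2) $(\varphi\Rightarrow(\psi\Rightarrow\gamma))\Rightarrow(\psi\Rightarrow(\varphi\Rightarrow\gamma))$; (S3) $\varphi\Rightarrow(\psi\Rightarrow\varphi)$; (S4) $\varphi\Rightarrow(\psi\Rightarrow(\varphi*\psi))$; (S5) $(\varphi\Rightarrow(\psi\Rightarrow\gamma))\Rightarrow((\varphi*\psi)\Rightarrow\gamma)$;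 (S6) $(\varphi\land\psi)\Rightarrow\varphi$; (S7) $(\varphi\land\psi)\Rightarrow\psi$; (S8) $(\varphi\Rightarrow\psi)\Rightarrow((\varphi\Rightarrow\gamma)\Rightarrow(\varphi\Rightarrow(\psi\land\gamma)))$; (S9) $\varphi\Rightarrow(\varphi\lor\psi)$; (S10) $\psi\Rightarrow(\varphi\lor\psi)$; (S11) $(\varphi\Rightarrow\gamma)\Rightarrow((\psi\Rightarrow\gamma)\Rightarrow((\varphi\lor\psi)\Rightarrow\gamma))$; (S12) $1$; (S13) $0\Rightarrow\varphi$; (S14) $((\varphi\Rightarrow0)\Rightarrow0)\Rightarrow\varphi$; (S15) $(\varphi\Rightarrow(\varphi\Rightarrow(\varphi\Rightarrow\psi)))\Rightarrow(\varphi\Rightarrow(\varphi\Rightarrow\psi))$. -}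

module Defs where

open import Data.Nat using (ℕ)
open import Data.List using (List; []; _∷_; foldr)
open import Data.Product using (Σ; _×_)
open import Relation.Binary.PropositionalEquality using (_≡_)

data FmS : Set where
  var  : ℕ → FmS
  _∧_  : FmS → FmS → FmS
  _∨_  : FmS → FmS → FmS
  _⇒_  : FmS → FmS → FmS
  ¬_   : FmS → FmS
  𝟘    : FmS

infixr 5 _⇒_
infixl 7 _∧_
infixl 6 _∨_
infix 30 ¬_

data FmS' : Set where
  var  : ℕ → FmS'
  _∧_  : FmS' → FmS' → FmS'
  _∨_  : FmS' → FmS' → FmS'
  _*_  : FmS' → FmS' → FmS'
  _⇒_  : FmS' → FmS' → FmS'
  𝟘    : FmS'
  𝟙    : FmS'

infixl 7 _*_

data FmL : Set where
  var  : ℕ → FmL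
  _∧_  : FmL → FmL → FmL
  _∨_  : FmL → FmL → FmL
  _*_  : FmL → FmL → FmL
  _⇒_  : FmL → FmL → FmL
  ¬_   : FmL → FmL
  𝟘    : FmL
  𝟙    : FmL

module S-abbrev where
  _⇔_ : FmS → FmS → FmS
  φ ⇔ ψ = (φ ⇒ ψ) ∧ (ψ ⇒ φ)

  𝟙S : FmS
  𝟙S = ¬ 𝟘

  _⇒²_ : FmS → FmS → FmS
  φ ⇒² ψ = φ ⇒ (φ ⇒ ψ)

  _⇛_ : List FmS → FmS → FmS
  Γ ⇛ φ = foldr _⇒_ φ Γ

  infixr 4 _⇛_ _⇛²_
  _⇛²_ : List FmS → FmS → FmS
  Γ ⇛² φ = foldr _⇒²_ φ Γ

open S-abbrev

data _⊢S_ (T : FmS → Set) : FmS → Set where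
  hyp  : ∀ {φ} → T φ → T ⊢S φ
  A1   : ∀ φ → T ⊢S (φ ⇒ φ)
  A2   : ∀ ψ → T ⊢S (𝟘 ⇒ ψ)
  A3   : ∀ φ → T ⊢S (¬ φ ⇒ (φ ⇒ 𝟘))
  A4   : T ⊢S 𝟙S
  A5   : ∀ φ ψ → T ⊢S ((φ ⇒ ψ) ⇔ (¬ ψ ⇒ ¬ φ))
  P    : ∀ Γ φ ψ γ → T ⊢S (Γ ⇛ (φ ⇒ (ψ ⇒ γ))) → T ⊢S (Γ ⇛ (ψ ⇒ (φ ⇒ γ)))
  C    : ∀ φ γ → T ⊢S (φ ⇒ (φ ⇒ (φ ⇒ γ))) → T ⊢S (φ ⇒ (φ ⇒ γ))
  E    : ∀ Γ φ γ → T ⊢S (Γ ⇛ φ) → T ⊢S (φ ⇒ γ) → T ⊢S (Γ ⇛ γ)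
  ⇒l   : ∀ Γ φ ψ γ → T ⊢S (Γ ⇛ φ) → T ⊢S (ψ ⇒ γ) → T ⊢S (Γ ⇛ ((φ ⇒ ψ) ⇒ γ))
  ⇒r   : ∀ φ γ → T ⊢S γ → T ⊢S (φ ⇒ γ)
  ∧l1  : ∀ φ ψ γ → T ⊢S (φ ⇒ γ) → T ⊢S ((φ ∧ ψ) ⇒ γ)
  ∧l2  : ∀ φ ψ γ → T ⊢S (ψ ⇒ γ) → T ⊢S ((φ ∧ ψ) ⇒ γ)
  ∧r   : ∀ Γ φ ψ → T ⊢S (Γ ⇛ φ) → T ⊢S (Γ ⇛ ψ) → T ⊢S (Γ ⇛ (φ ∧ ψ))
  ∨l1  : ∀ φ ψ γ → T ⊢S (φ ⇒ γ) → T ⊢S (ψ ⇒ γ) → T ⊢S ((φ ∨ ψ) ⇒ γ)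
  ∨l2  : ∀ φ ψ γ → T ⊢S (φ ⇒² γ) → T ⊢S (ψ ⇒² γ) → T ⊢S ((φ ∨ ψ) ⇒² γ)
  ∨r1  : ∀ Γ φ ψ → T ⊢S (Γ ⇛ φ) → T ⊢S (Γ ⇛ (φ ∨ ψ))
  ∨r2  : ∀ Γ φ ψ → T ⊢S (Γ ⇛ ψ) → T ⊢S (Γ ⇛ (φ ∨ ψ))
  ¬⇒l  : ∀ φ ψ γ → T ⊢S ((φ ∧ ¬ ψ) ⇒ γ) → T ⊢S (¬ (φ ⇒ ψ) ⇒ γ)
  ¬⇒r  : ∀ Γ φ ψ → T ⊢S (Γ ⇛² (φ ∧ ¬ ψ)) → T ⊢S (Γ ⇛² ¬ (φ ⇒ ψ))
  ¬∧l  : ∀ φ ψ γ → T ⊢S ((¬ φ ∨ ¬ ψ) ⇒ γ) → T ⊢S (¬ (φ ∧ ψ) ⇒ γ)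
  ¬∧r  : ∀ Γ φ ψ → T ⊢S (Γ ⇛ (¬ φ ∨ ¬ ψ)) → T ⊢S (Γ ⇛ ¬ (φ ∧ ψ))
  ¬∨l  : ∀ φ ψ γ → T ⊢S ((¬ φ ∧ ¬ ψ) ⇒ γ) → T ⊢S (¬ (φ ∨ ψ) ⇒ γ)
  ¬∨r  : ∀ Γ φ ψ → T ⊢S (Γ ⇛ (¬ φ ∧ ¬ ψ)) → T ⊢S (Γ ⇛ ¬ (φ ∨ ψ))
  ¬¬l  : ∀ φ γ → T ⊢S (φ ⇒ γ) → T ⊢S (¬ ¬ φ ⇒ γ)
  ¬¬r  : ∀ Γ φ → T ⊢S (Γ ⇛ φ) → T ⊢S (Γ ⇛ ¬ ¬ φ)

data _⊢S'_ (T : FmS' → Set) : FmS' → Set where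
  hyp  : ∀ {φ} → T φ → T ⊢S' φ
  MP   : ∀ {φ ψ} → T ⊢S' φ → T ⊢S' (φ ⇒ ψ) → T ⊢S' ψ
  S1   : ∀ φ ψ γ → T ⊢S' ((φ ⇒ ψ) ⇒ ((ψ ⇒ γ) ⇒ (φ ⇒ γ)))
  S2   : ∀ φ ψ γ → T ⊢S' ((φ ⇒ (ψ ⇒ γ)) ⇒ (ψ ⇒ (φ ⇒ γ)))
  S3   : ∀ φ ψ → T ⊢S' (φ ⇒ (ψ ⇒ φ))
  S4   : ∀ φ ψ → T ⊢S' (φ ⇒ (ψ ⇒ (φ * ψ)))
  S5   : ∀ φ ψ γ → T ⊢S' ((φ ⇒ (ψ ⇒ γ)) ⇒ ((φ * ψ) ⇒ γ))
  S6   : ∀ φ ψ → T ⊢S' ((φ ∧ ψ) ⇒ φ)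
  S7   : ∀ φ ψ → T ⊢S' ((φ ∧ ψ) ⇒ ψ)
  S8   : ∀ φ ψ γ → T ⊢S' ((φ ⇒ ψ) ⇒ ((φ ⇒ γ) ⇒ (φ ⇒ (ψ ∧ γ))))
  S9   : ∀ φ ψ → T ⊢S' (φ ⇒ (φ ∨ ψ))
  S10  : ∀ φ ψ → T ⊢S' (ψ ⇒ (φ ∨ ψ))
  S11  : ∀ φ ψ γ → T ⊢S' ((φ ⇒ γ) ⇒ ((ψ ⇒ γ) ⇒ ((φ ∨ ψ) ⇒ γ)))
  S12  : T ⊢S' 𝟙
  S13  : ∀ φ → T ⊢S' (𝟘 ⇒ φ)
  S14  : ∀ φ → T ⊢S' (((φ ⇒ 𝟘) ⇒ 𝟘) ⇒ φ)
  S15  : ∀ φ ψ → T ⊢S' ((φ ⇒ (φ ⇒ (φ ⇒ ψ))) ⇒ (φ ⇒ (φ ⇒ ψ)))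

toS : FmL → FmS
toS (var n) = var n
toS (φ ∧ ψ) = toS φ ∧ toS ψ
toS (φ ∨ ψ) = toS φ ∨ toS ψ
toS (φ * ψ) = ¬ (toS φ ⇒ ¬ toS ψ)
toS (φ ⇒ ψ) = toS φ ⇒ toS ψ
toS (¬ φ)   = ¬ toS φ
toS 𝟘       = 𝟘
toS 𝟙       = ¬ 𝟘

toS' : FmL → FmS'
toS' (var n) = var n
toS' (φ ∧ ψ) = toS' φ ∧ toS' ψ
toS' (φ ∨ ψ) = toS' φ ∨ toS' ψ
toS' (φ * ψ) = toS' φ * toS' ψ
toS' (φ ⇒ ψ) = toS' φ ⇒ toS' ψ
toS' (¬ φ)   = toS' φ ⇒ 𝟘
toS' 𝟘       = 𝟘
toS' 𝟙       = 𝟙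

image : {A B : Set} → (A → B) → (A → Set) → B → Set
image f T b = Σ _ (λ a → T a × f a ≡ b)

_⊢S⁺_ : (FmL → Set) → FmL → Set
T ⊢S⁺ φ = image toS T ⊢S toS φ

_⊢S'⁺_ : (FmL → Set) → FmL → Set
T ⊢S'⁺ φ = image toS' T ⊢S' toS' φ

module Submission where

-- Both calculi prove the axioms B, C, K of the implicational BCK-logic, so we
-- first develop BCK-reasoning once for an arbitrary theory closed under modus
-- ponens: composition, permutation, weakening, and cutting below a prefix
-- Γ ⇛ a = γ₁ ⇒ … ⇒ γₙ ⇒ a.  Then each direction is a syntactic simulation:
--   * tr : FmS → FmS' reads ¬φ as φ ⇒ 0; every axiom and rule of S is shown
--     admissible in S' (the contraction axiom S15 handles rules C, ∨l2, ¬⇒r);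
--   * tr' : FmS' → FmS reads φ * ψ as ¬(φ ⇒ ¬ψ) and 1 as ¬0; every axiom of
--     S' is derivable in S and modus ponens is rule E with empty Γ.
-- Finally the two unfoldings of a formula of the common language are provably
-- equivalent in each calculus (tr ∘ toS vs toS' and tr' ∘ toS' vs toS), which
-- transports premisses and conclusions and yields the theorem.

open import Defs
open import Function.Bundles using (_⇔_; mk⇔)
open import Data.Bool using (Bool; true; false)
open import Data.List using (List; []; _∷_; foldr; map; _++_)
open import Data.List.Properties using (foldr-++)
open import Data.Product using (_,_; proj₁; proj₂; _×_)
open import Relation.Binary.PropositionalEquality using (_≡_; refl; subst; sym; cong)

open S-abbrev using () renaming (_⇛_ to _⇛ˢ_; _⇛²_ to _⇛²ˢ_)

module Prefix {F : Set} (_⟶_ : F → F → F) where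
  _⇛_ : List F → F → F
  Γ ⇛ a = foldr _⟶_ a Γ

  _⇛²_ : List F → F → F
  Γ ⇛² a = foldr (λ γ r → γ ⟶ (γ ⟶ r)) a Γ

module BCK {F : Set} (_⟶_ : F → F → F) (Th : F → Set)
  (mp  : ∀ {a b} → Th a → Th (a ⟶ b) → Th b)
  (axB : ∀ a b c → Th ((a ⟶ b) ⟶ ((b ⟶ c) ⟶ (a ⟶ c))))
  (axC : ∀ a b c → Th ((a ⟶ (b ⟶ c)) ⟶ (b ⟶ (a ⟶ c))))
  (axK : ∀ a b → Th (a ⟶ (b ⟶ a))) where

  open Prefix _⟶_ public

  perm : ∀ {a b c} → Th (a ⟶ (b ⟶ c)) → Th (b ⟶ (a ⟶ c))
  perm p = mp p (axC _ _ _)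

  -- Identity is derivable: permute K to (a ⟶ a ⟶ a) ⟶ (a ⟶ a), a K-instance.
  idI : ∀ a → Th (a ⟶ a)
  idI a = mp (axK a a) (perm (axK a (a ⟶ (a ⟶ a))))

  trans : ∀ {a b c} → Th (a ⟶ b) → Th (b ⟶ c) → Th (a ⟶ c)
  trans p q = mp q (mp p (axB _ _ _))

  wk : ∀ {c} a → Th c → Th (a ⟶ c)
  wk a p = mp p (axK _ a)

  appI : ∀ a b → Th (a ⟶ ((a ⟶ b) ⟶ b))
  appI a b = perm (idI (a ⟶ b))

  preI : ∀ a b c → Th ((b ⟶ c) ⟶ ((a ⟶ b) ⟶ (a ⟶ c)))
  preI a b c = perm (axB a b c)

  pre : ∀ {b c} a → Th (b ⟶ c) → Th ((a ⟶ b) ⟶ (a ⟶ c))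
  pre a p = mp p (preI a _ _)

  post : ∀ {a b} c → Th (a ⟶ b) → Th ((b ⟶ c) ⟶ (a ⟶ c))
  post c p = mp p (axB _ _ c)

  ⟶-mono : ∀ {a a' b b'} → Th (a' ⟶ a) → Th (b ⟶ b') → Th ((a ⟶ b) ⟶ (a' ⟶ b'))
  ⟶-mono {b = b} p q = trans (post b p) (pre _ q)

  ⇛-monoI : ∀ Γ a b → Th ((a ⟶ b) ⟶ ((Γ ⇛ a) ⟶ (Γ ⇛ b)))
  ⇛-monoI [] a b = idI _
  ⇛-monoI (g ∷ Γ) a b = trans (⇛-monoI Γ a b) (preI g (Γ ⇛ a) (Γ ⇛ b))

  -- Cut below a prefix: this is how the context-carrying rules of S behave.
  cut : ∀ Γ {a b} → Th (Γ ⇛ a) → Th (a ⟶ b) → Th (Γ ⇛ b)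
  cut Γ p q = mp p (mp q (⇛-monoI Γ _ _))

  sw : ∀ Γ {a b c} → Th (Γ ⇛ (a ⟶ (b ⟶ c))) → Th (Γ ⇛ (b ⟶ (a ⟶ c)))
  sw Γ p = cut Γ p (axC _ _ _)

  wkAt : ∀ Γ {c} y → Th (Γ ⇛ c) → Th (Γ ⇛ (y ⟶ c))
  wkAt Γ y p = cut Γ p (axK _ y)

  comb : ∀ Γ Δ {a b c} → Th (Γ ⇛ a) → Th (Δ ⇛ b) → Th (a ⟶ (b ⟶ c)) → Th ((Γ ++ Δ) ⇛ c)
  comb Γ Δ {a} {b} {c} p q r =
    subst Th (sym (foldr-++ _⟶_ c Γ Δ)) (cut Γ (cut Γ p r) (mp q (perm (⇛-monoI Δ b c))))

  infix 2 _≈_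
  _≈_ : F → F → Set
  a ≈ b = Th (a ⟶ b) × Th (b ⟶ a)

  ≈-refl : ∀ a → a ≈ a
  ≈-refl a = idI a , idI a

  ≈-trans : ∀ {a b c} → a ≈ b → b ≈ c → a ≈ c
  ≈-trans (p , p') (q , q') = trans p q , trans q' p'

  ⟶-cong : ∀ {a a' b b'} → a ≈ a' → b ≈ b' → (a ⟶ b) ≈ (a' ⟶ b')
  ⟶-cong (p , p') (q , q') = ⟶-mono p' q , ⟶-mono p q'

module S'-Theory (U : FmS' → Set) where
  Th : FmS' → Set
  Th = U ⊢S'_

  open BCK _⇒_ Th MP S1 S2 S3 public

  infix 30 ∼_
  ∼_ : FmS' → FmS'
  ∼ a = a ⇒ 𝟘

  contra : ∀ {x y} → Th (x ⇒ y) → Th (∼ y ⇒ ∼ x)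
  contra p = post 𝟘 p

  dni : ∀ x → Th (x ⇒ ∼ ∼ x)
  dni x = appI x 𝟘

  ∧-intro : ∀ {x a b} → Th (x ⇒ a) → Th (x ⇒ b) → Th (x ⇒ (a ∧ b))
  ∧-intro {x} {a} {b} p q = MP q (MP p (S8 x a b))

  conj : ∀ {x y} → Th x → Th y → Th (x ∧ y)
  conj p q = MP S12 (∧-intro (wk 𝟙 p) (wk 𝟙 q))

  ∨-elim : ∀ {a b r} → Th (a ⇒ r) → Th (b ⇒ r) → Th ((a ∨ b) ⇒ r)
  ∨-elim {a} {b} {r} p q = MP q (MP p (S11 a b r))

  ∧-cong : ∀ {a a' b b'} → a ≈ a' → b ≈ b' → (a ∧ b) ≈ (a' ∧ b')
  ∧-cong (p , p') (q , q') = ∧-intro (trans (S6 _ _) p) (trans (S7 _ _) q)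
                            , ∧-intro (trans (S6 _ _) p') (trans (S7 _ _) q')

  ∨-cong : ∀ {a a' b b'} → a ≈ a' → b ≈ b' → (a ∨ b) ≈ (a' ∨ b')
  ∨-cong (p , p') (q , q') = ∨-elim (trans p (S9 _ _)) (trans q (S10 _ _))
                            , ∨-elim (trans p' (S9 _ _)) (trans q' (S10 _ _))

  *-≈ : ∀ a b → (a * b) ≈ ∼ (a ⇒ ∼ b)
  *-≈ a b = MP (sw (a ∷ []) (sw [] (idI (a ⇒ ∼ b)))) (S5 a b _)
          , trans (contra (sw [] (sw (a ∷ []) (cut (a ∷ b ∷ []) (S4 a b) (dni (a * b))))))
                  (S14 (a * b))

  ∧-⇛ : ∀ Δ {a b} → Th (((Δ ⇛ a) ∧ (Δ ⇛ b)) ⇒ (Δ ⇛ (a ∧ b)))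
  ∧-⇛ [] = idI _
  ∧-⇛ (g ∷ Δ) {a} {b} =
    let A = Δ ⇛ a
        B = Δ ⇛ b
        X = (g ⇒ A) ∧ (g ⇒ B)
        onA = MP (S6 (g ⇒ A) (g ⇒ B)) (S5 X g A)
        onB = MP (S7 (g ⇒ A) (g ⇒ B)) (S5 X g B)
    in trans (trans (S4 X g) (pre g (∧-intro onA onB))) (pre g (∧-⇛ Δ))

  -- A doubled implication A ⇒ A ⇒ B lifts through a doubled prefix Δ ⇛² _;
  -- each antecedent is used four times and contracted back by S15 (rule ¬⇒r).
  ⇛²-lift : ∀ Δ {A B} → Th (A ⇒ (A ⇒ B)) → Th ((Δ ⇛² A) ⇒ ((Δ ⇛² A) ⇒ (Δ ⇛² B)))
  ⇛²-lift [] k = k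
  ⇛²-lift (g ∷ Δ) {A} {B} k =
    let X = Δ ⇛² A
        Y = Δ ⇛² B
        V = g ⇒ (g ⇒ X)
        useV : Th ((V ∷ g ∷ g ∷ []) ⇛ X)
        useV = idI V
        twice = comb (V ∷ g ∷ g ∷ []) (V ∷ g ∷ g ∷ []) useV useV (⇛²-lift Δ k)
        sorted = sw (V ∷ []) (sw (V ∷ g ∷ []) twice)
    in cut (V ∷ V ∷ []) (cut (V ∷ V ∷ []) sorted (S15 g (g ⇒ Y))) (S15 g Y)

  -- Rule ∨l2: among any three disjuncts of a ∨ b two coincide, giving
  -- d ⇒ d ⇒ d ⇒ c for d = a ∨ b by three ∨-eliminations; S15 contracts once.
  ∨-elim² : ∀ {a b c} → Th (a ⇒ (a ⇒ c)) → Th (b ⇒ (b ⇒ c)) → Th ((a ∨ b) ⇒ ((a ∨ b) ⇒ c))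
  ∨-elim² {a} {b} {c} pa pb = MP thrice (S15 (a ∨ b) c)
    where
    pick : Bool → FmS'
    pick true  = a
    pick false = b

    elimFront : ∀ {r} → (∀ x → Th (pick x ⇒ r)) → Th ((a ∨ b) ⇒ r)
    elimFront f = ∨-elim (f true) (f false)

    rot : ∀ {x y z} → Th (x ⇒ (y ⇒ (z ⇒ c))) → Th (y ⇒ (z ⇒ (x ⇒ c)))
    rot {y = y} p = sw (y ∷ []) (sw [] p)

    dupFirst : ∀ {x} z → Th (x ⇒ (x ⇒ c)) → Th (x ⇒ (x ⇒ (z ⇒ c)))
    dupFirst {x} z p = wkAt (x ∷ x ∷ []) z p

    dupOuter : ∀ {x} y → Th (x ⇒ (x ⇒ c)) → Th (x ⇒ (y ⇒ (x ⇒ c)))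
    dupOuter {x} y p = sw (x ∷ []) (dupFirst y p)

    triple : ∀ x y z → Th (pick x ⇒ (pick y ⇒ (pick z ⇒ c)))
    triple true  true  true  = wk a pa
    triple true  true  false = dupFirst b pa
    triple true  false true  = dupOuter b pa
    triple true  false false = wk a pb
    triple false true  true  = wk b pa
    triple false true  false = dupOuter a pb
    triple false false true  = dupFirst a pb
    triple false false false = wk b pb

    thrice : Th ((a ∨ b) ⇒ ((a ∨ b) ⇒ ((a ∨ b) ⇒ c)))
    thrice = elimFront λ z → rot (elimFront λ y → rot (elimFront λ x → triple x y z))

  -- Axiom A5 (contraposition as an equivalence); the converse uses S14.
  A5′ : ∀ a b → Th (((a ⇒ b) ⇒ (∼ b ⇒ ∼ a)) ∧ ((∼ b ⇒ ∼ a) ⇒ (a ⇒ b)))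
  A5′ a b =
    let N = ∼ b ⇒ ∼ a
        toDN = cut (N ∷ []) (S1 (∼ b) (∼ a) 𝟘) (post _ (dni a))
    in conj (S1 a b 𝟘) (cut (N ∷ []) toDN (pre a (S14 b)))

  ¬⇒-intro : ∀ a b → Th (a ⇒ (∼ b ⇒ ∼ (a ⇒ b)))
  ¬⇒-intro a b =
    let useImp : Th (((a ⇒ b) ∷ a ∷ []) ⇛ b)
        useImp = idI (a ⇒ b)
        useNeg : Th ((∼ b ∷ []) ⇛ ∼ b)
        useNeg = idI _
    in sw (a ∷ []) (sw [] (comb ((a ⇒ b) ∷ a ∷ []) (∼ b ∷ []) useImp useNeg (appI b 𝟘)))

  ¬⇒-intro² : ∀ Δ {a b} → Th (Δ ⇛² (a ∧ ∼ b)) → Th (Δ ⇛² ∼ (a ⇒ b))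
  ¬⇒-intro² Δ {a} {b} d =
    let A = a ∧ ∼ b
        split = comb (A ∷ []) (A ∷ []) (S6 a (∼ b)) (S7 a (∼ b)) (¬⇒-intro a b)
    in MP d (MP d (⇛²-lift Δ split))

  ¬⇒-elim : ∀ a b → Th (∼ (a ⇒ b) ⇒ (a ∧ ∼ b))
  ¬⇒-elim a b = ∧-intro (trans (contra (pre a (S13 b))) (S14 a)) (contra (S3 b a))

  ¬∧-elim : ∀ a b → Th (∼ (a ∧ b) ⇒ (∼ a ∨ ∼ b))
  ¬∧-elim a b =
    let both = ∧-intro (trans (contra (S9 (∼ a) (∼ b))) (S14 a))
                       (trans (contra (S10 (∼ a) (∼ b))) (S14 b))
    in trans (contra both) (S14 _)

  ¬∧-intro : ∀ a b → Th ((∼ a ∨ ∼ b) ⇒ ∼ (a ∧ b))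
  ¬∧-intro a b = ∨-elim (contra (S6 a b)) (contra (S7 a b))

  ¬∨-elim : ∀ a b → Th (∼ (a ∨ b) ⇒ (∼ a ∧ ∼ b))
  ¬∨-elim a b = ∧-intro (contra (S9 a b)) (contra (S10 a b))

  ¬∨-intro : ∀ a b → Th ((∼ a ∧ ∼ b) ⇒ ∼ (a ∨ b))
  ¬∨-intro a b = perm (∨-elim (perm (S6 (∼ a) (∼ b))) (perm (S7 (∼ a) (∼ b))))

tr : FmS → FmS'
tr (var n) = var n
tr (a ∧ b) = tr a ∧ tr b
tr (a ∨ b) = tr a ∨ tr b
tr (a ⇒ b) = tr a ⇒ tr b
tr (¬ a)   = tr a ⇒ 𝟘
tr 𝟘       = 𝟘

module _ where
  open Prefix {FmS'} _⇒_

  tr-⇛ : ∀ Γ x → tr (Γ ⇛ˢ x) ≡ (map tr Γ ⇛ tr x)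
  tr-⇛ [] x = refl
  tr-⇛ (g ∷ Γ) x = cong (tr g ⇒_) (tr-⇛ Γ x)

  tr-⇛² : ∀ Γ x → tr (Γ ⇛²ˢ x) ≡ (map tr Γ ⇛² tr x)
  tr-⇛² [] x = refl
  tr-⇛² (g ∷ Γ) x = cong (λ z → tr g ⇒ (tr g ⇒ z)) (tr-⇛² Γ x)

module S→S' (T : FmL → Set) where
  open S'-Theory (image toS' T)

  unfold-≈ : ∀ a → toS' a ≈ tr (toS a)
  unfold-≈ (var n) = ≈-refl _
  unfold-≈ (a ∧ b) = ∧-cong (unfold-≈ a) (unfold-≈ b)
  unfold-≈ (a ∨ b) = ∨-cong (unfold-≈ a) (unfold-≈ b)
  unfold-≈ (a * b) =
    ≈-trans (*-≈ _ _) (⟶-cong (⟶-cong (unfold-≈ a) (⟶-cong (unfold-≈ b) (≈-refl 𝟘))) (≈-refl 𝟘))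
  unfold-≈ (a ⇒ b) = ⟶-cong (unfold-≈ a) (unfold-≈ b)
  unfold-≈ (¬ a)   = ⟶-cong (unfold-≈ a) (≈-refl 𝟘)
  unfold-≈ 𝟘       = ≈-refl _
  unfold-≈ 𝟙       = wk 𝟙 (idI 𝟘) , wk (𝟘 ⇒ 𝟘) S12

  -- A single-premiss rule of S acting below Γ becomes a cut below map tr Γ.
  under : ∀ Γ {x y} → Th (tr (Γ ⇛ˢ x)) → Th (tr x ⇒ tr y) → Th (tr (Γ ⇛ˢ y))
  under Γ {x} {y} d f rewrite tr-⇛ Γ x | tr-⇛ Γ y = cut (map tr Γ) d f

  ∧-under : ∀ Γ {x y} → Th (tr (Γ ⇛ˢ x)) → Th (tr (Γ ⇛ˢ y)) → Th (tr (Γ ⇛ˢ (x ∧ y)))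
  ∧-under Γ {x} {y} d e rewrite tr-⇛ Γ x | tr-⇛ Γ y | tr-⇛ Γ (x ∧ y) =
    MP (conj d e) (∧-⇛ (map tr Γ))

  ¬⇒-under² : ∀ Γ {x y} → Th (tr (Γ ⇛²ˢ (x ∧ ¬ y))) → Th (tr (Γ ⇛²ˢ ¬ (x ⇒ y)))
  ¬⇒-under² Γ {x} {y} d rewrite tr-⇛² Γ (x ∧ ¬ y) | tr-⇛² Γ (¬ (x ⇒ y)) =
    ¬⇒-intro² (map tr Γ) d

  simulate : ∀ {ψ} → image toS T ⊢S ψ → Th (tr ψ)
  simulate (hyp (a , Ta , refl)) = MP (hyp (a , Ta , refl)) (proj₁ (unfold-≈ a))
  simulate (A1 φ)               = idI _
  simulate (A2 ψ)               = S13 _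
  simulate (A3 φ)               = idI _
  simulate A4                   = idI 𝟘
  simulate (A5 φ ψ)             = A5′ (tr φ) (tr ψ)
  simulate (P Γ φ ψ γ d)        = under Γ (simulate d) (S2 _ _ _)
  simulate (C φ γ d)            = MP (simulate d) (S15 _ _)
  simulate (E Γ φ γ d e)        = under Γ (simulate d) (simulate e)
  simulate (⇒l Γ φ ψ γ d e)     = under Γ (simulate d) (perm (pre _ (simulate e)))
  simulate (⇒r φ γ d)           = wk _ (simulate d)
  simulate (∧l1 φ ψ γ d)        = trans (S6 _ _) (simulate d)
  simulate (∧l2 φ ψ γ d)        = trans (S7 _ _) (simulate d)
  simulate (∧r Γ φ ψ d e)       = ∧-under Γ (simulate d) (simulate e)
  simulate (∨l1 φ ψ γ d e)      = ∨-elim (simulate d) (simulate e)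
  simulate (∨l2 φ ψ γ d e)      = ∨-elim² (simulate d) (simulate e)
  simulate (∨r1 Γ φ ψ d)        = under Γ (simulate d) (S9 _ _)
  simulate (∨r2 Γ φ ψ d)        = under Γ (simulate d) (S10 _ _)
  simulate (¬⇒l φ ψ γ d)        = trans (¬⇒-elim _ _) (simulate d)
  simulate (¬⇒r Γ φ ψ d)        = ¬⇒-under² Γ (simulate d)
  simulate (¬∧l φ ψ γ d)        = trans (¬∧-elim _ _) (simulate d)
  simulate (¬∧r Γ φ ψ d)        = under Γ (simulate d) (¬∧-intro _ _)
  simulate (¬∨l φ ψ γ d)        = trans (¬∨-elim _ _) (simulate d)
  simulate (¬∨r Γ φ ψ d)        = under Γ (simulate d) (¬∨-intro _ _)
  simulate (¬¬l φ γ d)          = trans (S14 _) (simulate d)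
  simulate (¬¬r Γ φ d)          = under Γ (simulate d) (dni _)

  sound : ∀ φ → T ⊢S⁺ φ → T ⊢S'⁺ φ
  sound φ d = MP (simulate d) (proj₂ (unfold-≈ φ))

module S-Theory (U : FmS → Set) where
  Th : FmS → Set
  Th = U ⊢S_

  mp : ∀ {a b} → Th a → Th (a ⇒ b) → Th b
  mp {a} {b} p q = E [] a b p q

  s1 : ∀ a b c → Th ((a ⇒ b) ⇒ ((b ⇒ c) ⇒ (a ⇒ c)))
  s1 a b c =
    let useAB = ⇒l (a ∷ []) a b b (A1 a) (A1 b)
        useBC = ⇒l (a ∷ (a ⇒ b) ∷ []) b c c useAB (A1 c)
    in P ((a ⇒ b) ∷ []) a (b ⇒ c) c (P [] a (a ⇒ b) ((b ⇒ c) ⇒ c) useBC)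

  s2 : ∀ a b c → Th ((a ⇒ (b ⇒ c)) ⇒ (b ⇒ (a ⇒ c)))
  s2 a b c = P ((a ⇒ (b ⇒ c)) ∷ []) a b c (A1 _)

  s3 : ∀ a b → Th (a ⇒ (b ⇒ a))
  s3 a b = P [] b a a (⇒r b (a ⇒ a) (A1 a))

  open BCK _⇒_ Th mp s1 s2 s3 public

  contraI : ∀ x y → Th ((x ⇒ y) ⇒ (¬ y ⇒ ¬ x))
  contraI x y = mp (A5 x y) (∧l1 _ _ _ (A1 _))

  contra : ∀ {x y} → Th (x ⇒ y) → Th (¬ y ⇒ ¬ x)
  contra p = mp p (contraI _ _)

  dni : ∀ x → Th (x ⇒ ¬ ¬ x)
  dni x = ¬¬r (x ∷ []) x (A1 x)

  dne : ∀ x → Th (¬ ¬ x ⇒ x)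
  dne x = ¬¬l x x (A1 x)

  ¬-≈ : ∀ x → ¬ x ≈ (x ⇒ 𝟘)
  ¬-≈ x = A3 x , trans (contraI x 𝟘) (⇒l [] (¬ 𝟘) (¬ x) (¬ x) A4 (A1 (¬ x)))

  ¬-cong : ∀ {a a'} → a ≈ a' → ¬ a ≈ ¬ a'
  ¬-cong (p , p') = contra p' , contra p

  ∧-cong : ∀ {a a' b b'} → a ≈ a' → b ≈ b' → (a ∧ b) ≈ (a' ∧ b')
  ∧-cong (p , p') (q , q') = ∧r (_ ∷ []) _ _ (∧l1 _ _ _ p) (∧l2 _ _ _ q)
                            , ∧r (_ ∷ []) _ _ (∧l1 _ _ _ p') (∧l2 _ _ _ q')

  ∨-cong : ∀ {a a' b b'} → a ≈ a' → b ≈ b' → (a ∨ b) ≈ (a' ∨ b')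
  ∨-cong (p , p') (q , q') = ∨l1 _ _ _ (∨r1 (_ ∷ []) _ _ p) (∨r2 (_ ∷ []) _ _ q)
                            , ∨l1 _ _ _ (∨r1 (_ ∷ []) _ _ p') (∨r2 (_ ∷ []) _ _ q')

  s4 : ∀ a b → Th (a ⇒ (b ⇒ ¬ (a ⇒ ¬ b)))
  s4 a b = cut (a ∷ []) (cut (a ∷ []) (appI a (¬ b)) (contraI (a ⇒ ¬ b) (¬ b)))
                        (post (¬ (a ⇒ ¬ b)) (dni b))

  s5 : ∀ a b c → Th ((a ⇒ (b ⇒ c)) ⇒ (¬ (a ⇒ ¬ b) ⇒ c))
  s5 a b c =
    let W = a ⇒ (b ⇒ c)
        useW : Th ((W ∷ a ∷ []) ⇛ (b ⇒ c))
        useW = A1 W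
        contraposed = sw (W ∷ []) (cut (W ∷ a ∷ []) useW (contraI b c))
    in cut (W ∷ []) (cut (W ∷ []) contraposed (contraI (¬ c) (a ⇒ ¬ b))) (pre _ (dne c))

  s8 : ∀ a b c → Th ((a ⇒ b) ⇒ ((a ⇒ c) ⇒ (a ⇒ (b ∧ c))))
  s8 a b c = ∧r ((a ⇒ b) ∷ (a ⇒ c) ∷ a ∷ []) b c
                (sw [] (wk (a ⇒ c) (A1 (a ⇒ b)))) (wk (a ⇒ b) (A1 (a ⇒ c)))

  s11 : ∀ a b c → Th ((a ⇒ c) ⇒ ((b ⇒ c) ⇒ ((a ∨ b) ⇒ c)))
  s11 a b c =
    let fromA = wkAt (a ∷ (a ⇒ c) ∷ []) (b ⇒ c) (appI a c)
        fromB = wkAt (b ∷ []) (a ⇒ c) (appI b c)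
    in sw ((a ⇒ c) ∷ []) (sw [] (∨l1 a b ((a ⇒ c) ⇒ ((b ⇒ c) ⇒ c)) fromA fromB))

  s14 : ∀ a → Th (((a ⇒ 𝟘) ⇒ 𝟘) ⇒ a)
  s14 a = trans (trans (post 𝟘 (A3 a)) (proj₂ (¬-≈ (¬ a)))) (dne a)

  -- Contraction S15 is rule C after moving the outer hypothesis inside.
  s15 : ∀ a b → Th ((a ⇒ (a ⇒ (a ⇒ b))) ⇒ (a ⇒ (a ⇒ b)))
  s15 a b =
    let W = a ⇒ (a ⇒ (a ⇒ b))
        useW : Th ((W ∷ a ∷ a ∷ a ∷ []) ⇛ b)
        useW = A1 W
        inside = sw (a ∷ a ∷ []) (sw (a ∷ []) (sw [] useW))
    in sw [] (sw (a ∷ []) (C a (W ⇒ b) inside))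

tr' : FmS' → FmS
tr' (var n) = var n
tr' (a ∧ b) = tr' a ∧ tr' b
tr' (a ∨ b) = tr' a ∨ tr' b
tr' (a * b) = ¬ (tr' a ⇒ ¬ tr' b)
tr' (a ⇒ b) = tr' a ⇒ tr' b
tr' 𝟘       = 𝟘
tr' 𝟙       = ¬ 𝟘

module S'→S (T : FmL → Set) where
  open S-Theory (image toS T)

  unfold-≈ : ∀ a → toS a ≈ tr' (toS' a)
  unfold-≈ (var n) = ≈-refl _
  unfold-≈ (a ∧ b) = ∧-cong (unfold-≈ a) (unfold-≈ b)
  unfold-≈ (a ∨ b) = ∨-cong (unfold-≈ a) (unfold-≈ b)
  unfold-≈ (a * b) = ¬-cong (⟶-cong (unfold-≈ a) (¬-cong (unfold-≈ b)))
  unfold-≈ (a ⇒ b) = ⟶-cong (unfold-≈ a) (unfold-≈ b)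
  unfold-≈ (¬ a)   = ≈-trans (¬-cong (unfold-≈ a)) (¬-≈ _)
  unfold-≈ 𝟘       = ≈-refl _
  unfold-≈ 𝟙       = ≈-refl _

  simulate : ∀ {χ} → image toS' T ⊢S' χ → Th (tr' χ)
  simulate (hyp (a , Ta , refl)) = mp (hyp (a , Ta , refl)) (proj₁ (unfold-≈ a))
  simulate (MP d e)    = mp (simulate d) (simulate e)
  simulate (S1 a b c)  = s1 _ _ _
  simulate (S2 a b c)  = s2 _ _ _
  simulate (S3 a b)    = s3 _ _
  simulate (S4 a b)    = s4 _ _
  simulate (S5 a b c)  = s5 _ _ _
  simulate (S6 a b)    = ∧l1 _ _ _ (A1 _)
  simulate (S7 a b)    = ∧l2 _ _ _ (A1 _)
  simulate (S8 a b c)  = s8 _ _ _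
  simulate (S9 a b)    = ∨r1 (_ ∷ []) _ _ (A1 _)
  simulate (S10 a b)   = ∨r2 (_ ∷ []) _ _ (A1 _)
  simulate (S11 a b c) = s11 _ _ _
  simulate S12         = A4
  simulate (S13 a)     = A2 _
  simulate (S14 a)     = s14 _
  simulate (S15 a b)   = s15 _ _

  complete : ∀ φ → T ⊢S'⁺ φ → T ⊢S⁺ φ
  complete φ d = mp (simulate d) (proj₂ (unfold-≈ φ))

corollary4p3 : (T : FmL → Set) (φ : FmL) → (T ⊢S⁺ φ) ⇔ (T ⊢S'⁺ φ)
corollary4p3 T φ = mk⇔ (S→S'.sound T φ) (S'→S.complete T φ)
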